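{- Let $r\ge 3$ and $m,n$ be integers with $n>(r-1)m$. Let $G_1\in\mathcal{T}_{r-1}(n,m)$ be a graph in which no copy of $K_r$ intersects the $m$-set $M\subset V(G_1)$, and let $v\in V(G_1)\setminus M$ be a vertex whose neighbourhood in $G_1$ is $V(G_1)\setminus(M\cup\{v\})$. Obtain $G_2$ from $G_1$ by deleting all edges incident to $v$ and inserting $n-m-1$ edges incident to $v$, of which at least one goes to $M$. If no copy of $K_r$ in $G_2$ intersects $M$, then $G_2\in\mathcal{T}_{r-1}(n,m)$.
   Context: $T_{r-1}(N)$ denotes the Turán graph, the complete $(r-1)$-partite graph on $N$ vertices with part sizes differing by at most one. For $n>(r-1)m$ the family $\mathcal{T}_{r-1}(n,m)$ is defined as follows: start with $T_{r-1}((r-1)m)$ with colour classes $V_1,\dots,V_{r-1}$ and an arbitrary set $M$ of $m$ vertices in $V_1\cup\dots\cup V_{r-1}$. Add $r-1$ new vertices $v_1,\dots,v_{r-1}$ (called sporadic), where $v_i$ is adjacent to all old and new vertices except those in $V_i$ (and itself). Then add a set $Y$ of $n-(r-1)m$ new vertices, each adjacent to all old and new vertices except those in $M$ (and itself). Call the resulting $(n+r-1)$-vertex graph $G_r(n,M)$. Then $\mathcal{T}_{r-1}(n,m)$ is the family of $n$-vertex graphs obtainable from some graph $G_r(n,M)$ by deleting any $r-1$ vertices from $\{v_1,\dots,v_{r-1}\}\cup Y$. -}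

module Defs where

open import Data.Nat using (ℕ; _*_; _∸_)
open import Data.Fin using (Fin; remQuot)
open import Data.Fin.Subset using (Subset; _∈_; _∉_; ∣_∣)
open import Data.Bool using (Bool; true; false)
open import Data.Vec using (tabulate)
open import Data.Product using (Σ; ∃; _×_; proj₁)
open import Data.Unit using (⊤)
open import Data.Empty using (⊥)
open import Relation.Nullary using (¬_)
open import Relation.Binary.PropositionalEquality using (_≡_; _≢_)
open import Function.Definitions using (Injective)
open import Function.Bundles using (_⇔_)

record SimpleGraph (n : ℕ) : Set where
  field
    adj    : Fin n → Fin n → Bool
    sym    : ∀ a b → adj a b ≡ adj b a
    irrefl : ∀ a → adj a a ≡ false
open SimpleGraph public

nbhd : ∀ {n} → SimpleGraph n → Fin n → Subset n
nbhd G v = tabulate (λ u → adj G v u)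

-- Vertices of G_r(n,M), with k = r-1 colour classes of size m each
-- (the Turán graph T_k(k m)), k sporadic vertices, and y extra vertices (Y).
data Vtx (k m y : ℕ) : Set where
  tur : Fin (k * m) → Vtx k m y
  spo : Fin k → Vtx k m y
  yv  : Fin y → Vtx k m y

part : ∀ {k m} → Fin (k * m) → Fin k
part {k} {m} i = proj₁ (remQuot {k} m i)

-- Adjacency of G_r(n,M), where Mt ⊆ V(T_k(k m)) is the set M.
GrAdj : ∀ {k m y} → Subset (k * m) → Vtx k m y → Vtx k m y → Set
GrAdj {k} {m} Mt (tur i) (tur j) = part {k} {m} i ≢ part {k} {m} j
GrAdj {k} {m} Mt (tur i) (spo s) = part {k} {m} i ≢ s
GrAdj {k} {m} Mt (tur i) (yv _)  = i ∉ Mt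
GrAdj {k} {m} Mt (spo s) (tur i) = s ≢ part {k} {m} i
GrAdj {k} {m} Mt (spo s) (spo t) = s ≢ t
GrAdj {k} {m} Mt (spo s) (yv _)  = ⊤
GrAdj {k} {m} Mt (yv _)  (tur i) = i ∉ Mt
GrAdj {k} {m} Mt (yv _)  (spo _) = ⊤
GrAdj {k} {m} Mt (yv a)  (yv b)  = a ≢ b

InMt : ∀ {k m y} → Subset (k * m) → Vtx k m y → Set
InMt Mt (tur i) = i ∈ Mt
InMt Mt (spo _) = ⊥
InMt Mt (yv _)  = ⊥

-- G ∈ T_{r-1}(n,m), with M ⊆ V(G) being the m-set M of the construction:
-- G is isomorphic to the subgraph of G_r(n,M) induced by the image of an
-- injective map emb containing all Turán vertices (so exactly r-1 vertices of
-- {v_1..v_{r-1}} ∪ Y are deleted), and M corresponds to the construction's M.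
record InT (r n m : ℕ) (G : SimpleGraph n) (M : Subset n) : Set where
  field
    Mt      : Subset ((r ∸ 1) * m)
    Mt-size : ∣ Mt ∣ ≡ m
    emb     : Fin n → Vtx (r ∸ 1) m (n ∸ (r ∸ 1) * m)
    emb-inj : Injective _≡_ _≡_ emb
    emb-tur : ∀ i → ∃ λ a → emb a ≡ tur i
    emb-adj : ∀ a b → (adj G a b ≡ true) ⇔ GrAdj Mt (emb a) (emb b)
    emb-M   : ∀ a → (a ∈ M) ⇔ InMt Mt (emb a)

InFamily : (r n m : ℕ) → SimpleGraph n → Set
InFamily r n m G = ∃ λ (M : Subset n) → InT r n m G M

KrMeets : ∀ {n} (r : ℕ) → SimpleGraph n → Subset n → Set
KrMeets {n} r G M =
  Σ (Fin r → Fin n) λ c →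
    Injective _≡_ _≡_ c ×
    (∀ i j → i ≢ j → adj G (c i) (c j) ≡ true) ×
    (∃ λ i → c i ∈ M)

-- Since v has no neighbour in M, the vertex v of G₁ cannot be a Turán vertex:
-- a Turán vertex outside M sees some vertex of M, because M has m vertices and
-- so does every colour class. After the re-wiring v still misses a whole colour
-- class V_l of the Turán part: otherwise v, its neighbour in M and neighbours
-- in all other classes V_p ∪ {v_p} would span a K_r meeting M. Counting
-- non-neighbours, v is then adjacent in G₂ to every vertex outside V_l ∪ {v},
-- and the sporadic vertex v_l is unused by G₂ - v (again by the clique
-- argument). So G₂ is embedded into G_r(n,M) by sending v to v_l and keeping
-- the embedding of G₁ elsewhere.
module Submission where

open import Defs hiding (sym)
open import Data.Nat using (ℕ; zero; suc; _+_; _*_; _∸_; _≤_; _<_)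
open import Data.Nat.Properties
  using ( ∸-+-assoc; +-comm; ≤-total; ≤-reflexive; m∸[m∸n]≡n; m≤n⇒m∸n≡0; <-irrefl
        ; module ≤-Reasoning)
open import Data.Fin using (Fin; zero; suc; _≟_; remQuot; combine)
open import Data.Fin.Properties
  using ( injective⇒≤; suc-injective; any?; all?; ¬∀⟶∃¬
        ; remQuot-combine; combine-remQuot; combine-injective)
open import Data.Fin.Subset using (Subset; _∈_; _∉_; ∣_∣; ∁)
open import Data.Fin.Subset.Properties using (x∉p⇒x∈∁p; ∣∁p∣≡n∸∣p∣)
open import Data.Bool using (true; false)
import Data.Bool as Bool
open import Data.Vec using (_∷_; here; there)
open import Data.Vec.Properties using ([]=⇒lookup; lookup∘tabulate)
open import Data.Vec.Functional using () renaming (_∷_ to _◂_)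
open import Data.Product using (∃; _×_; _,_; proj₁; proj₂; uncurry)
open import Data.Sum using (inj₁; inj₂)
open import Data.Unit using (tt)
open import Data.Empty using (⊥; ⊥-elim)
open import Relation.Nullary using (¬_; Dec; yes; no)
open import Relation.Binary.PropositionalEquality
open import Function.Definitions using (Injective)
open import Function.Bundles using (_⇔_; mk⇔; Equivalence)
open Equivalence using (to; from)

enum : ∀ {n} (S : Subset n) → Fin ∣ S ∣ → Fin n
enum (true ∷ S) zero = zero
enum (true ∷ S) (suc z) = suc (enum S z)
enum (false ∷ S) z = suc (enum S z)

enum-injective : ∀ {n} (S : Subset n) → Injective _≡_ _≡_ (enum S)
enum-injective (true ∷ S) {zero} {zero} _ = refl
enum-injective (true ∷ S) {suc x} {suc y} e = cong suc (enum-injective S (suc-injective e))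
enum-injective (false ∷ S) e = enum-injective S (suc-injective e)

enum-∈ : ∀ {n} (S : Subset n) z → enum S z ∈ S
enum-∈ (true ∷ S) zero = here
enum-∈ (true ∷ S) (suc z) = there (enum-∈ S z)
enum-∈ (false ∷ S) z = there (enum-∈ S z)

∈⇒enum : ∀ {n} {S : Subset n} {x} → x ∈ S → ∃ λ z → enum S z ≡ x
∈⇒enum {S = true ∷ S} here = zero , refl
∈⇒enum {S = true ∷ S} (there x∈S) = let z , e = ∈⇒enum x∈S in suc z , cong suc e
∈⇒enum {S = false ∷ S} (there x∈S) = let z , e = ∈⇒enum x∈S in z , cong suc e

injective⇒≤∣p∣ : ∀ {m n} {p : Subset n} {f : Fin m → Fin n} →
  Injective _≡_ _≡_ f → (∀ x → f x ∈ p) → m ≤ ∣ p ∣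
injective⇒≤∣p∣ {p = p} {f} f-inj f∈p = injective⇒≤ {f = index} index-inj
  where
  index : _ → Fin ∣ p ∣
  index x = proj₁ (∈⇒enum (f∈p x))
  enum-index : ∀ x → enum p (index x) ≡ f x
  enum-index x = proj₂ (∈⇒enum (f∈p x))
  index-inj : Injective _≡_ _≡_ index
  index-inj {x} {y} e = f-inj (trans (sym (enum-index x)) (trans (cong (enum p) e) (enum-index y)))

◂-injective : ∀ {A : Set} {m} {a : A} {f : Fin m → A} →
  Injective _≡_ _≡_ f → (∀ x → f x ≢ a) → Injective _≡_ _≡_ (a ◂ f)
◂-injective f-inj a∉f {zero} {zero} _ = refl
◂-injective f-inj a∉f {zero} {suc y} e = ⊥-elim (a∉f y (sym e))
◂-injective f-inj a∉f {suc x} {zero} e = ⊥-elim (a∉f x e)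
◂-injective f-inj a∉f {suc x} {suc y} e = cong suc (f-inj e)

m∸[m∸n]≤n : ∀ m n → m ∸ (m ∸ n) ≤ n
m∸[m∸n]≤n m n with ≤-total n m
... | inj₁ n≤m = ≤-reflexive (m∸[m∸n]≡n n≤m)
... | inj₂ m≤n rewrite m≤n⇒m∸n≡0 m≤n = m≤n

true≢false : true ≢ false
true≢false ()

bool-≢false : ∀ {b} → b ≢ false → b ≡ true
bool-≢false {true} _ = refl
bool-≢false {false} b≢false = ⊥-elim (b≢false refl)

adj≡false⇒∉nbhd : ∀ {n} (G : SimpleGraph n) {v u} → adj G v u ≡ false → u ∉ nbhd G v
adj≡false⇒∉nbhd G {v} {u} nonadj u∈ =
  true≢false (trans (sym ([]=⇒lookup u∈)) (trans (lookup∘tabulate (adj G v) u) nonadj))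

pairwise-adjacent⇒injective : ∀ {n r} (G : SimpleGraph n) (c : Fin r → Fin n) →
  (∀ a b → a ≢ b → adj G (c a) (c b) ≡ true) → Injective _≡_ _≡_ c
pairwise-adjacent⇒injective G c c-adj {a} {b} e with a ≟ b
... | yes a≡b = a≡b
... | no a≢b = ⊥-elim (true≢false (trans (sym (c-adj a b a≢b))
                 (trans (cong (λ x → adj G x (c b)) e) (irrefl G (c b)))))

remainder : ∀ {k m} → Fin (k * m) → Fin m
remainder {k} {m} i = proj₂ (remQuot {k} m i)

part-combine : ∀ {k m} (p : Fin k) (x : Fin m) → part {k} {m} (combine p x) ≡ p
part-combine {k} {m} p x = cong proj₁ (remQuot-combine {k} {m} p x)

part-remainder-injective : ∀ {k m} {i j : Fin (k * m)} →
  part {k} {m} i ≡ part {k} {m} j → remainder {k} i ≡ remainder {k} j → i ≡ j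
part-remainder-injective {k} {m} {i} {j} p≡ r≡ = begin
  i                                  ≡⟨ sym (combine-remQuot {k} m i) ⟩
  uncurry combine (remQuot {k} m i)  ≡⟨ cong₂ combine p≡ r≡ ⟩
  uncurry combine (remQuot {k} m j)  ≡⟨ combine-remQuot {k} m j ⟩
  j                                  ∎
  where open ≡-Reasoning

-- The remainders of t and of the members of S are pairwise distinct elements of Fin m.
∣S∣<m-in-part : ∀ {k m} (S : Subset (k * m)) (t : Fin (k * m)) → t ∉ S →
  (∀ s → s ∈ S → part {k} {m} s ≡ part {k} {m} t) → suc ∣ S ∣ ≤ m
∣S∣<m-in-part {k} {m} S t t∉S S⊆part = injective⇒≤ (◂-injective rem-inj rem≢t)
  where
  rem-inj : Injective _≡_ _≡_ (λ z → remainder {k} (enum S z))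
  rem-inj {x} {y} e = enum-injective S
    (part-remainder-injective (trans (S⊆part _ (enum-∈ S x)) (sym (S⊆part _ (enum-∈ S y)))) e)
  rem≢t : ∀ z → remainder {k} (enum S z) ≢ remainder {k} t
  rem≢t z e = t∉S (subst (_∈ S) (part-remainder-injective (S⊆part _ (enum-∈ S z)) e) (enum-∈ S z))

InClass : ∀ {k m y} → Fin k → Vtx k m y → Set
InClass {k} {m} p (tur i) = part {k} {m} i ≡ p
InClass p (spo s) = s ≡ p
InClass p (yv _) = ⊥

GrAdj-InClass : ∀ {k m y} (Mt : Subset (k * m)) {p q : Fin k} {x z : Vtx k m y} →
  p ≢ q → InClass p x → InClass q z → GrAdj Mt x z
GrAdj-InClass Mt {x = tur i} {tur j} p≢q refl refl = p≢q
GrAdj-InClass Mt {x = tur i} {spo s} p≢q refl refl = p≢q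
GrAdj-InClass Mt {x = spo s} {tur j} p≢q refl refl = p≢q
GrAdj-InClass Mt {x = spo s} {spo t} p≢q refl refl = p≢q

GrAdj-sym : ∀ {k m y} (Mt : Subset (k * m)) (x z : Vtx k m y) → GrAdj Mt x z → GrAdj Mt z x
GrAdj-sym Mt (tur i) (tur j) g = λ e → g (sym e)
GrAdj-sym Mt (tur i) (spo s) g = λ e → g (sym e)
GrAdj-sym Mt (tur i) (yv _) g = g
GrAdj-sym Mt (spo s) (tur i) g = λ e → g (sym e)
GrAdj-sym Mt (spo s) (spo t) g = λ e → g (sym e)
GrAdj-sym Mt (spo s) (yv _) g = tt
GrAdj-sym Mt (yv _) (tur i) g = g
GrAdj-sym Mt (yv _) (spo _) g = tt
GrAdj-sym Mt (yv a) (yv b) g = λ e → g (sym e)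

tur-injective : ∀ {k m y} {i j : Fin (k * m)} → tur {k} {m} {y} i ≡ tur j → i ≡ j
tur-injective refl = refl

module Rewiring (k m n : ℕ)
  (G₁ : SimpleGraph n) (M : Subset n) (T : InT (suc k) n m G₁ M)
  (v : Fin n) (v∉M : v ∉ M) (v-misses-M : ∀ w → w ∈ M → adj G₁ v w ≢ true)
  (G₂ : SimpleGraph n)
  (G₂≡G₁ : ∀ a b → a ≢ v → b ≢ v → adj G₂ a b ≡ adj G₁ a b)
  (degree : ∣ nbhd G₂ v ∣ ≡ n ∸ m ∸ 1)
  (u : Fin n) (u∈M : u ∈ M) (v~u : adj G₂ v u ≡ true)
  (no-Kr : ¬ KrMeets (suc k) G₂ M) where

  open InT T

  V : Set
  V = Vtx k m (n ∸ k * m)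

  turPre : Fin (k * m) → Fin n
  turPre t = proj₁ (emb-tur t)

  emb-turPre : ∀ t → emb (turPre t) ≡ tur t
  emb-turPre t = proj₂ (emb-tur t)

  turPre-injective : Injective _≡_ _≡_ turPre
  turPre-injective {s} {t} e =
    tur-injective (trans (sym (emb-turPre s)) (trans (cong emb e) (emb-turPre t)))

  emb-v≢tur : ∀ t → emb v ≢ tur t
  emb-v≢tur t emb-v≡t =
    <-irrefl refl (subst (λ s → suc s ≤ m) Mt-size (∣S∣<m-in-part Mt t t∉Mt Mt⊆part-t))
    where
    t∉Mt : t ∉ Mt
    t∉Mt t∈Mt = v∉M (from (emb-M v) (subst (InMt Mt) (sym emb-v≡t) t∈Mt))
    Mt⊆part-t : ∀ s → s ∈ Mt → part {k} {m} s ≡ part {k} {m} t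
    Mt⊆part-t s s∈Mt with part {k} {m} t ≟ part {k} {m} s
    ... | yes e = sym e
    ... | no parts≢ = ⊥-elim (v-misses-M (turPre s) pre-s∈M (from (emb-adj v (turPre s))
           (subst₂ (GrAdj Mt) (sym emb-v≡t) (sym (emb-turPre s)) parts≢)))
      where
      pre-s∈M : turPre s ∈ M
      pre-s∈M = from (emb-M (turPre s)) (subst (InMt Mt) (sym (emb-turPre s)) s∈Mt)

  emb≡tur⇒≢v : ∀ {w t} → emb w ≡ tur t → w ≢ v
  emb≡tur⇒≢v {t = t} e refl = emb-v≢tur t e

  HasNeighbourIn : Fin k → Set
  HasNeighbourIn p = ∃ λ w → w ≢ v × adj G₂ v w ≡ true × InClass p (emb w)

  no-rainbow : (w : ∀ p → HasNeighbourIn p) (p : Fin k) → proj₁ (w p) ∈ M → ⊥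
  no-rainbow w p wp∈M =
    no-Kr (clique , pairwise-adjacent⇒injective G₂ clique clique-adj , clique-adj , suc p , wp∈M)
    where
    clique : Fin (suc k) → Fin n
    clique = v ◂ (λ q → proj₁ (w q))
    clique-adj : ∀ a b → a ≢ b → adj G₂ (clique a) (clique b) ≡ true
    clique-adj zero zero a≢b = ⊥-elim (a≢b refl)
    clique-adj zero (suc q) _ = proj₁ (proj₂ (proj₂ (w q)))
    clique-adj (suc q) zero _ = trans (SimpleGraph.sym G₂ _ v) (proj₁ (proj₂ (proj₂ (w q))))
    clique-adj (suc q) (suc q′) q≢q′ =
      let (wq , wq≢v , _ , wq∈q) = w q ; (wq′ , wq′≢v , _ , wq′∈q′) = w q′ in
      trans (G₂≡G₁ wq wq′ wq≢v wq′≢v)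
            (from (emb-adj wq wq′) (GrAdj-InClass Mt (λ e → q≢q′ (cong suc e)) wq∈q wq′∈q′))

  tu : Fin (k * m)
  tu with emb u | to (emb-M u) u∈M
  ... | tur t | _ = t

  emb-u : emb u ≡ tur tu
  emb-u with emb u | to (emb-M u) u∈M
  ... | tur t | _ = refl

  i : Fin k
  i = part {k} {m} tu

  u-neighbour : HasNeighbourIn i
  u-neighbour =
    u , (λ u≡v → v∉M (subst (_∈ M) u≡v u∈M)) , v~u , subst (InClass i) (sym emb-u) refl

  not-every-class : (∀ p → p ≢ i → HasNeighbourIn p) → ⊥
  not-every-class nb = no-rainbow w i wi∈M
    where
    w : ∀ p → HasNeighbourIn p
    w p with p ≟ i
    ... | yes refl = u-neighbour
    ... | no p≢i = nb p p≢i
    wi∈M : proj₁ (w i) ∈ M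
    wi∈M with i ≟ i
    ... | yes refl = u∈M
    ... | no i≢i = ⊥-elim (i≢i refl)

  class : Fin k → Fin m → Fin n
  class p x = turPre (combine p x)

  class-neighbour : ∀ p x → adj G₂ v (class p x) ≡ true → HasNeighbourIn p
  class-neighbour p x v~ =
    class p x , emb≡tur⇒≢v (emb-turPre _) , v~
              , subst (InClass p) (sym (emb-turPre _)) (part-combine p x)

  missed-class : ∃ λ l → ∀ x → adj G₂ v (class l x) ≡ false
  missed-class with any? (λ p → all? (λ x → adj G₂ v (class p x) Bool.≟ false))
  ... | yes found = found
  ... | no none = ⊥-elim (not-every-class λ p _ →
          let x , v~x = ¬∀⟶∃¬ m _ (λ x → adj G₂ v (class p x) Bool.≟ false)
                                  (λ all → none (p , all))
          in class-neighbour p x (bool-≢false v~x))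

  l : Fin k
  l = proj₁ missed-class

  v≁class-l : ∀ x → adj G₂ v (class l x) ≡ false
  v≁class-l = proj₂ missed-class

  v≁part-l : ∀ t → part {k} {m} t ≡ l → adj G₂ v (turPre t) ≡ false
  v≁part-l t part≡l =
    subst (λ s → adj G₂ v (turPre s) ≡ false) combine-l-t (v≁class-l (remainder {k} t))
    where
    combine-l-t : combine l (remainder {k} t) ≡ t
    combine-l-t = part-remainder-injective (trans (part-combine l _) (sym part≡l))
                    (cong proj₂ (remQuot-combine {k} {m} l _))

  OutsideClass-l : Fin n → Set
  OutsideClass-l b = ∀ t → emb b ≡ tur t → part {k} {m} t ≢ l

  -- v has exactly m + 1 non-neighbours, and v together with class l already gives m + 1.
  adjacent-outside-l : ∀ b → b ≢ v → OutsideClass-l b → adj G₂ v b ≡ true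
  adjacent-outside-l b b≢v b∉l with adj G₂ v b in v≁b
  ... | true = refl
  ... | false = ⊥-elim (<-irrefl refl too-many)
    where
    non-neighbours : Fin (suc (suc m)) → Fin n
    non-neighbours = v ◂ (b ◂ class l)
    class-l-injective : Injective _≡_ _≡_ (class l)
    class-l-injective e = proj₂ (combine-injective l _ l _ (turPre-injective e))
    b∉class-l : ∀ x → class l x ≢ b
    b∉class-l x e = b∉l _ (trans (cong emb (sym e)) (emb-turPre _)) (part-combine l x)
    non-neighbours-injective : Injective _≡_ _≡_ non-neighbours
    non-neighbours-injective =
      ◂-injective (◂-injective class-l-injective b∉class-l)
        λ { zero → b≢v ; (suc x) → emb≡tur⇒≢v (emb-turPre _) }
    v≁ : ∀ x → adj G₂ v (non-neighbours x) ≡ false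
    v≁ zero = irrefl G₂ v
    v≁ (suc zero) = v≁b
    v≁ (suc (suc x)) = v≁class-l x
    too-many : suc (suc m) ≤ suc m
    too-many = begin
      suc (suc m)           ≤⟨ injective⇒≤∣p∣ non-neighbours-injective
                                 (λ x → x∉p⇒x∈∁p (adj≡false⇒∉nbhd G₂ (v≁ x))) ⟩
      ∣ ∁ (nbhd G₂ v) ∣     ≡⟨ ∣∁p∣≡n∸∣p∣ (nbhd G₂ v) ⟩
      n ∸ ∣ nbhd G₂ v ∣     ≡⟨ cong (n ∸_) (trans degree (∸-+-assoc n m 1)) ⟩
      n ∸ (n ∸ (m + 1))     ≤⟨ m∸[m∸n]≤n n (m + 1) ⟩
      m + 1                 ≡⟨ +-comm m 1 ⟩
      suc m                 ∎
      where open ≤-Reasoning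

  spo⇒OutsideClass-l : ∀ {b s} → emb b ≡ spo s → OutsideClass-l b
  spo⇒OutsideClass-l emb-b t emb-b′ with trans (sym emb-b) emb-b′
  ... | ()

  yv⇒OutsideClass-l : ∀ {b y} → emb b ≡ yv y → OutsideClass-l b
  yv⇒OutsideClass-l emb-b t emb-b′ with trans (sym emb-b) emb-b′
  ... | ()

  spo-l-free : ∀ w → w ≢ v → emb w ≢ spo l
  spo-l-free w w≢v emb-w≡l = not-every-class neighbour
    where
    neighbour : ∀ p → p ≢ i → HasNeighbourIn p
    neighbour p _ with p ≟ l
    ... | yes refl = w , w≢v , adjacent-outside-l w w≢v (spo⇒OutsideClass-l emb-w≡l)
                       , subst (InClass p) (sym emb-w≡l) refl
    ... | no p≢l = class-neighbour p x (adjacent-outside-l _ (emb≡tur⇒≢v (emb-turPre _)) outside)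
      where
      -- any vertex of class p will do; tu only witnesses that m ≠ 0
      x : Fin m
      x = remainder {k} tu
      outside : OutsideClass-l (class p x)
      outside t e part≡l = p≢l (trans (sym (part-combine p x))
        (trans (cong (part {k} {m}) (tur-injective (trans (sym (emb-turPre _)) e))) part≡l))

  place : (a : Fin n) → Dec (a ≡ v) → V
  place a (yes _) = spo l
  place a (no _) = emb a

  emb₂ : Fin n → V
  emb₂ a = place a (a ≟ v)

  emb₂-≢v : ∀ a → a ≢ v → emb₂ a ≡ emb a
  emb₂-≢v a a≢v with a ≟ v
  ... | yes a≡v = ⊥-elim (a≢v a≡v)
  ... | no _ = refl

  emb₂-injective : Injective _≡_ _≡_ emb₂
  emb₂-injective {a} {b} e with a ≟ v | b ≟ v
  ... | yes a≡v | yes b≡v = trans a≡v (sym b≡v)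
  ... | yes _ | no b≢v = ⊥-elim (spo-l-free b b≢v (sym e))
  ... | no a≢v | yes _ = ⊥-elim (spo-l-free a a≢v e)
  ... | no _ | no _ = emb-inj e

  emb₂-tur : ∀ t → ∃ λ a → emb₂ a ≡ tur t
  emb₂-tur t = turPre t , trans (emb₂-≢v _ (emb≡tur⇒≢v (emb-turPre t))) (emb-turPre t)

  v-row : ∀ b → b ≢ v → (adj G₂ v b ≡ true) ⇔ GrAdj Mt (spo l) (emb b)
  v-row b b≢v with emb b in emb-b
  ... | tur t = mk⇔
    (λ v~b l≡ → true≢false (trans (sym v~b)
       (subst (λ x → adj G₂ v x ≡ false) (emb-inj (trans (emb-turPre t) (sym emb-b)))
              (v≁part-l t (sym l≡)))))
    (λ l≢ → adjacent-outside-l b b≢v λ t′ e part≡l →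
       l≢ (trans (sym part≡l) (cong (part {k} {m}) (tur-injective (trans (sym e) emb-b)))))
  ... | spo s = mk⇔ (λ _ l≡s → spo-l-free b b≢v (trans emb-b (cong spo (sym l≡s))))
                    (λ _ → adjacent-outside-l b b≢v (spo⇒OutsideClass-l emb-b))
  ... | yv _ = mk⇔ (λ _ → tt) (λ _ → adjacent-outside-l b b≢v (yv⇒OutsideClass-l emb-b))

  emb₂-adj : ∀ a b → (adj G₂ a b ≡ true) ⇔ GrAdj Mt (emb₂ a) (emb₂ b)
  emb₂-adj a b with a ≟ v | b ≟ v
  ... | yes refl | yes refl =
    mk⇔ (λ v~v → ⊥-elim (true≢false (trans (sym v~v) (irrefl G₂ v)))) (λ l≢l → ⊥-elim (l≢l refl))
  ... | yes refl | no b≢v = v-row b b≢v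
  ... | no a≢v | yes refl = mk⇔
    (λ a~v → GrAdj-sym Mt _ _ (to (v-row a a≢v) (trans (SimpleGraph.sym G₂ v a) a~v)))
    (λ g → trans (SimpleGraph.sym G₂ a v) (from (v-row a a≢v) (GrAdj-sym Mt _ _ g)))
  ... | no a≢v | no b≢v = mk⇔
    (λ a~b → to (emb-adj a b) (trans (sym (G₂≡G₁ a b a≢v b≢v)) a~b))
    (λ g → trans (G₂≡G₁ a b a≢v b≢v) (from (emb-adj a b) g))

  emb₂-M : ∀ a → (a ∈ M) ⇔ InMt Mt (emb₂ a)
  emb₂-M a with a ≟ v
  ... | yes refl = mk⇔ v∉M ⊥-elim
  ... | no _ = emb-M a

  G₂∈T : InT (suc k) n m G₂ M
  G₂∈T = record
    { Mt = Mt ; Mt-size = Mt-size ; emb = emb₂ ; emb-inj = emb₂-injective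
    ; emb-tur = emb₂-tur ; emb-adj = emb₂-adj ; emb-M = emb₂-M }

lemma2p4 : (r m n : ℕ) → 3 ≤ r → (r ∸ 1) * m < n →
    (G₁ : SimpleGraph n) (M : Subset n) → InT r n m G₁ M →
    ¬ KrMeets r G₁ M →
    (v : Fin n) → v ∉ M →
    (∀ u → (adj G₁ v u ≡ true) ⇔ (u ∉ M × u ≢ v)) →
    (G₂ : SimpleGraph n) →
    (∀ a b → a ≢ v → b ≢ v → adj G₂ a b ≡ adj G₁ a b) →
    ∣ nbhd G₂ v ∣ ≡ n ∸ m ∸ 1 →
    (∃ λ u → u ∈ M × adj G₂ v u ≡ true) →
    ¬ KrMeets r G₂ M →
    InFamily r n m G₂
lemma2p4 (suc k) m n _ _ G₁ M T _ v v∉M v-nbhd G₂ G₂≡G₁ degree (u , u∈M , v~u) no-Kr =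
  M , Rewiring.G₂∈T k m n G₁ M T v v∉M v-misses-M G₂ G₂≡G₁ degree u u∈M v~u no-Kr
  where
  v-misses-M : ∀ w → w ∈ M → adj G₁ v w ≢ true
  v-misses-M w w∈M v~w = proj₁ (to (v-nbhd w) v~w) w∈M
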